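{- Let $G$ be a finite simple connected graph with $n=n(G)$ vertices and $m(G)$ edges, and suppose $\mathrm{gp}^-(G)=k\ge 2$ and $n\ge 2k-1$. Then $m(G)\le \binom{n}{2}-k+1$. Moreover, the unique graph of order $n$ attaining this bound is the graph obtained from the complete graph $K_n$ by deleting $k-1$ edges incident to a fixed vertex.
   Context: A set $S$ of vertices of a connected graph is a general position set if no shortest path contains three or more vertices of $S$; it is maximal if not properly contained in another general position set; $\mathrm{gp}^-(G)$ is the number of vertices in a smallest maximal general position set. -}

module Defs where

open import Data.Bool using (Bool; true; false; not; _∧_; if_then_else_)
open import Data.Bool.Properties using (∧-comm; ∧-assoc)
open import Data.Nat using (ℕ; zero; suc; _≤_; _<ᵇ_)
open import Data.List using (List; map)
open import Data.Nat.ListAction using (sum)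
open import Data.Fin using (Fin; toℕ; _≟_)
open import Data.Fin.Subset using (Subset; _∈_; _⊂_; ∣_∣)
open import Data.Vec using (lookup)
open import Data.List using () renaming (length to lengthL)
open import Data.List.Base using ()
open import Data.Product using (Σ; _×_; ∃; _,_)
open import Data.Sum using (_⊎_)
open import Data.Empty using (⊥; ⊥-elim)
open import Relation.Nullary using (¬_; yes; no)
open import Relation.Nullary.Decidable using (⌊_⌋)
open import Relation.Binary.PropositionalEquality using (_≡_; _≢_; refl; sym; cong; cong₂)
open import Data.Fin.Base using ()
import Data.List as L

record Graph (n : ℕ) : Set where
  field
    adj     : Fin n → Fin n → Bool
    adj-sym : ∀ x y → adj x y ≡ adj y x
    adj-irrefl : ∀ x → adj x x ≡ false

open Graph public

edgeCount : ∀ {n} → Graph n → ℕ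
edgeCount {n} G =
  sum (map (λ i → sum (map (λ j → if (toℕ i <ᵇ toℕ j) ∧ adj G i j then 1 else 0)
                           (L.allFin n)))
           (L.allFin n))

data Walk {n : ℕ} (G : Graph n) : Fin n → Fin n → Set where
  here : ∀ u → Walk G u u
  step : ∀ {u w v} → adj G u w ≡ true → Walk G w v → Walk G u v

len : ∀ {n} {G : Graph n} {u v} → Walk G u v → ℕ
len (here _)   = 0
len (step _ w) = suc (len w)

OnWalk : ∀ {n} {G : Graph n} {u v} → Fin n → Walk G u v → Set
OnWalk x (here u)         = x ≡ u
OnWalk x (step {u} _ w)   = x ≡ u ⊎ OnWalk x w

Shortest : ∀ {n} {G : Graph n} {u v} → Walk G u v → Set
Shortest {G = G} {u} {v} w = ∀ (w' : Walk G u v) → len w ≤ len w'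

Connected : ∀ {n} → Graph n → Set
Connected G = ∀ u v → Walk G u v

GeneralPosition : ∀ {n} → Graph n → Subset n → Set
GeneralPosition {n} G S =
  ∀ (u v : Fin n) (w : Walk G u v) → Shortest w →
  ∀ (x y z : Fin n) → x ∈ S → y ∈ S → z ∈ S →
  x ≢ y → x ≢ z → y ≢ z →
  OnWalk x w → OnWalk y w → OnWalk z w → ⊥

MaximalGP : ∀ {n} → Graph n → Subset n → Set
MaximalGP G S = GeneralPosition G S × (∀ T → S ⊂ T → ¬ GeneralPosition G T)

GpMinusIs : ∀ {n} → Graph n → ℕ → Set
GpMinusIs G k =
  (∃ λ S → MaximalGP G S × ∣ S ∣ ≡ k) × (∀ S → MaximalGP G S → k ≤ ∣ S ∣)

SameGraph : ∀ {n} → Graph n → Graph n → Set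
SameGraph G H = ∀ x y → adj G x y ≡ adj H x y

-- K_n with the edges v–d (d ∈ D) deleted.

private
  eqᵇ : ∀ {n} → Fin n → Fin n → Bool
  eqᵇ x y = ⌊ x ≟ y ⌋

  eqᵇ-sym : ∀ {n} (x y : Fin n) → eqᵇ x y ≡ eqᵇ y x
  eqᵇ-sym x y with x ≟ y | y ≟ x
  ... | yes _  | yes _ = refl
  ... | no _   | no _  = refl
  ... | yes p  | no ¬q = ⊥-elim (¬q (sym p))
  ... | no ¬p  | yes q = ⊥-elim (¬p (sym q))

  eqᵇ-refl : ∀ {n} (x : Fin n) → eqᵇ x x ≡ true
  eqᵇ-refl x with x ≟ x
  ... | yes _ = refl
  ... | no ¬p = ⊥-elim (¬p refl)

  starAdj : ∀ {n} → Fin n → Subset n → Fin n → Fin n → Bool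
  starAdj v D x y =
    not (eqᵇ x y) ∧ (not (eqᵇ x v ∧ lookup D y) ∧ not (eqᵇ y v ∧ lookup D x))

  starAdj-sym : ∀ {n} v D (x y : Fin n) → starAdj v D x y ≡ starAdj v D y x
  starAdj-sym v D x y =
    cong₂ _∧_ (cong not (eqᵇ-sym x y))
              (∧-comm (not (eqᵇ x v ∧ lookup D y)) (not (eqᵇ y v ∧ lookup D x)))

  starAdj-irrefl : ∀ {n} v D (x : Fin n) → starAdj v D x x ≡ false
  starAdj-irrefl v D x rewrite eqᵇ-refl x = refl

deleteStar : ∀ {n} → Fin n → Subset n → Graph n
deleteStar v D = record
  { adj    = starAdj v D
  ; adj-sym = starAdj-sym v D
  ; adj-irrefl = starAdj-irrefl v D
  }

{-# OPTIONS --safe #-}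
module Submission where

-- Since k < n, G is not complete (in a complete graph every vertex set is in general position, so
-- gp⁻ = n). Extend a non-adjacent pair {a, b} to a maximal general position set S, so |S| ≥ k. Every
-- s ∈ S other than a has a partner in {a, b} to which it is not adjacent, for otherwise a – s – b
-- would be a shortest path through three vertices of S; the spokes {s, partner s} are pairwise
-- distinct non-edges, so G misses at least |S| - 1 ≥ k - 1 edges. When equality holds the spokes are
-- all the non-edges, the partners of the vertices of S outside {a, b} all coincide with a single
-- c ∈ {a, b}, and G is K_n minus the edges from c to S - c. Conversely, in K_n minus the k - 1 edges
-- from v to D, a vertex outside {v} ∪ D is adjacent to all others, so the diameter is 2 and a set is in
-- general position unless it contains v, a vertex of D and a vertex outside {v} ∪ D; this makes
-- {v} ∪ D a smallest maximal general position set.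

open import Defs
open import Algebra.Properties.CommutativeSemigroup using (interchange)
open import Data.Bool using (Bool; true; false; not; _∧_; if_then_else_; T)
open import Data.Bool.Properties using (T-∧; T-not-≡) renaming (_≟_ to _≟ᵇ_)
open import Data.Empty using (⊥)
open import Data.Nat using (ℕ; zero; suc; _+_; _*_; _∸_; _≤_; _≤?_; _<ᵇ_; z≤n; s≤s)
open import Data.Nat.Properties
  using (≤-refl; ≤-reflexive; ≤-trans; ≤-antisym; ≤-pred; ≤⇒≯; <⇒≢; <-irrefl; 1+n≰n; <ᵇ⇒<;
         +-comm; +-suc; +-identityʳ; +-commutativeSemigroup; +-monoʳ-≤; +-cancelˡ-≡; ∸-monoʳ-≤;
         m≤n+m; m+n≤o⇒m≤o∸n)
  renaming (_≟_ to _≟ℕ_)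
open import Data.Nat.Combinatorics using (_C_; nC1≡n; nCk+nC[k+1]≡[n+1]C[k+1])
open import Data.Nat.ListAction using (sum)
open import Data.Nat.ListAction.Properties using (sum-++)
open import Data.Fin using (Fin; zero; suc; toℕ; _≟_)
open import Data.Fin.Properties using (toℕ-injective; suc-injective; any?; all?)
open import Data.Fin.Subset
  using (Subset; inside; outside; _∈_; _∉_; _⊆_; _⊂_; _⊃_; ∣_∣; ⁅_⁆; _∪_; _─_; _-_; ∁; ⊤; Nonempty)
open import Data.Fin.Subset.Properties
  using (_∈?_; anySubset?; nonempty?; Empty-unique; drop-there; drop-not-there; ⊆-refl; ⊆-trans;
         ⊆-antisym; p⊂q⇒p⊆q; p⊆q⇒∣p∣≤∣q∣; p⊆p∪q; x∈p∪q⁺; x∈p∪q⁻; x∈⁅x⁆; x∈⁅y⁆⇒x≡y; x∈∁p⇒x∉p; ∈⊤;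
         p─⊥≡p; p─q⊆p; x∈p∧x≢y⇒x∈p-y; ∪-identityˡ; ∣⊤∣≡n; ∣⊥∣≡0; ∣⁅x⁆∣≡1; ∣∁p∣≡n∸∣p∣)
open import Data.Fin.Subset.Induction using (Acc; acc; ⊃-wellFounded)
open import Data.Vec using ([]; _∷_; here; there; lookup)
open import Data.Vec.Properties using ([]=⇒lookup; lookup⇒[]=)
open import Data.List using (List; []; _∷_; _++_; length; map; filterᵇ; cartesianProduct; allFin)
open import Data.List.Properties
  using (length-map; length-tabulate; length-removeAt′; map-++; map-∘; map-cong; map-tabulate)
import Data.List.Relation.Unary.All as All
open import Data.List.Relation.Unary.AllPairs using ([]; _∷_)
open import Data.List.Relation.Unary.Any using (here; there)
open import Data.List.Relation.Unary.Unique.Propositional using (Unique)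
import Data.List.Relation.Unary.Unique.Propositional.Properties as Unique
open import Data.List.Membership.Propositional using () renaming (_∈_ to _∈ᴸ_; _∉_ to _∉ᴸ_; _─_ to _─ᴸ_)
open import Data.List.Membership.Propositional.Properties
  using (∈-map⁺; ∈-map⁻; ∈-filter⁺; ∈-filter⁻; ∈-cartesianProduct⁺; ∈-allFin)
import Data.List.Membership.DecPropositional as DecMembership
open import Data.List.Relation.Binary.Subset.Propositional using () renaming (_⊆_ to _⊆ᴸ_)
open import Data.Product using (Σ; ∃; _×_; _,_; proj₁; proj₂; uncurry)
open import Data.Product.Properties using (≡-dec)
open import Data.Sum using (_⊎_; inj₁; inj₂)
open import Effect.Monad using (RawMonad)
open import Function using (_∘_; id; Equivalence; case_of_)
open import Level using (0ℓ)
open import Relation.Binary.Definitions using (DecidableEquality)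
open import Relation.Binary.PropositionalEquality
open import Relation.Nullary using (¬_; Dec; yes; no; contradiction; ¬?; _×-dec_; _⊎-dec_)
open import Relation.Nullary.Decidable using (decidable-stable; ¬¬-excluded-middle)
open import Relation.Nullary.Negation using (¬¬-Monad; ¬¬-map)

distinct₃ : ∀ {A : Set} {x y z : A} → x ≢ y → x ≢ z → y ≢ z → Unique (x ∷ y ∷ z ∷ [])
distinct₃ x≢y x≢z y≢z = (x≢y All.∷ x≢z All.∷ All.[]) ∷ (y≢z All.∷ All.[]) ∷ All.[] ∷ []

module _ {A : Set} where

  ∈-─⁺ : ∀ {x y : A} xs (x∈xs : x ∈ᴸ xs) → y ∈ᴸ xs → y ≢ x → y ∈ᴸ xs ─ᴸ x∈xs
  ∈-─⁺ (_ ∷ _)  (here refl)  (here refl)  y≢x = contradiction refl y≢x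
  ∈-─⁺ (_ ∷ _)  (here refl)  (there y∈xs) _   = y∈xs
  ∈-─⁺ (_ ∷ _)  (there _)    (here refl)  _   = here refl
  ∈-─⁺ (_ ∷ xs) (there x∈xs) (there y∈xs) y≢x = there (∈-─⁺ xs x∈xs y∈xs y≢x)

  unique∧xs⊆ys⇒|xs|≤|ys| : ∀ {xs ys : List A} → Unique xs → xs ⊆ᴸ ys → length xs ≤ length ys
  unique∧xs⊆ys⇒|xs|≤|ys| {[]}          _            _       = z≤n
  unique∧xs⊆ys⇒|xs|≤|ys| {x ∷ xs} {ys} (x∉xs ∷ xs!) x∷xs⊆ys =
    subst (suc (length xs) ≤_) (sym (length-removeAt′ ys _))
      (s≤s (unique∧xs⊆ys⇒|xs|≤|ys| xs! xs⊆ys─x))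
    where
    x∈ys = x∷xs⊆ys (here refl)
    xs⊆ys─x : xs ⊆ᴸ ys ─ᴸ x∈ys
    xs⊆ys─x y∈xs = ∈-─⁺ ys x∈ys (x∷xs⊆ys (there y∈xs)) λ where refl → All.lookup x∉xs y∈xs refl

  module _ (_≟_ : DecidableEquality A) where
    open DecMembership _≟_ using () renaming (_∈?_ to _∈ᴸ?_)

    unique∧xs⊆ys∧|ys|≤|xs|⇒ys⊆xs : ∀ {xs ys : List A} → Unique xs → xs ⊆ᴸ ys →
                                   length ys ≤ length xs → ys ⊆ᴸ xs
    unique∧xs⊆ys∧|ys|≤|xs|⇒ys⊆xs {xs} {ys} xs! xs⊆ys |ys|≤|xs| {y} y∈ys with y ∈ᴸ? xs
    ... | yes y∈xs = y∈xs
    ... | no  y∉xs = contradiction (unique∧xs⊆ys⇒|xs|≤|ys| y∷xs! y∷xs⊆ys) (≤⇒≯ |ys|≤|xs|)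
      where
      y∷xs! : Unique (y ∷ xs)
      y∷xs! = All.tabulate (λ { x∈xs refl → y∉xs x∈xs }) ∷ xs!
      y∷xs⊆ys : y ∷ xs ⊆ᴸ ys
      y∷xs⊆ys (here refl)  = y∈ys
      y∷xs⊆ys (there x∈xs) = xs⊆ys x∈xs

elements : ∀ {n} → Subset n → List (Fin n)
elements []            = []
elements (inside ∷ p)  = zero ∷ map suc (elements p)
elements (outside ∷ p) = map suc (elements p)

length-elements : ∀ {n} (p : Subset n) → length (elements p) ≡ ∣ p ∣
length-elements []            = refl
length-elements (inside ∷ p)  = cong suc (trans (length-map suc (elements p)) (length-elements p))
length-elements (outside ∷ p) = trans (length-map suc (elements p)) (length-elements p)

∈-elements⁺ : ∀ {n} {p : Subset n} {x} → x ∈ p → x ∈ᴸ elements p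
∈-elements⁺ {p = inside ∷ _}  here        = here refl
∈-elements⁺ {p = inside ∷ _}  (there x∈p) = there (∈-map⁺ suc (∈-elements⁺ x∈p))
∈-elements⁺ {p = outside ∷ _} (there x∈p) = ∈-map⁺ suc (∈-elements⁺ x∈p)

∈-elements⁻ : ∀ {n} {p : Subset n} {x} → x ∈ᴸ elements p → x ∈ p
∈-elements⁻ {p = inside ∷ _}  (here refl) = here
∈-elements⁻ {p = inside ∷ _}  (there x∈)  with ∈-map⁻ suc x∈
... | _ , y∈ , refl = there (∈-elements⁻ y∈)
∈-elements⁻ {p = outside ∷ _} x∈          with ∈-map⁻ suc x∈
... | _ , y∈ , refl = there (∈-elements⁻ y∈)

elements-unique : ∀ {n} (p : Subset n) → Unique (elements p)
elements-unique []            = []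
elements-unique (inside ∷ p)  =
  All.tabulate (λ { x∈ refl → zero∉map-suc x∈ }) ∷ Unique.map⁺ suc-injective (elements-unique p)
  where
  zero∉map-suc : zero ∉ᴸ map suc (elements p)
  zero∉map-suc 0∈ with ∈-map⁻ suc 0∈
  ... | _ , _ , ()
elements-unique (outside ∷ p) = Unique.map⁺ suc-injective (elements-unique p)

x∈p∪⁅y⁆⁻ : ∀ {n} {p : Subset n} {x y} → x ∈ p ∪ ⁅ y ⁆ → x ∈ p ⊎ x ≡ y
x∈p∪⁅y⁆⁻ {p = p} {y = y} x∈ with x∈p∪q⁻ p ⁅ y ⁆ x∈
... | inj₁ x∈p   = inj₁ x∈p
... | inj₂ x∈⁅y⁆ = inj₂ (x∈⁅y⁆⇒x≡y y x∈⁅y⁆)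

x∈p─q⇒x∉q : ∀ {n} {p q : Subset n} {x} → x ∈ p ─ q → x ∉ q
x∈p─q⇒x∉q {p = _ ∷ _} {q = outside ∷ _} here          ()
x∈p─q⇒x∉q {p = _ ∷ _} {q = _ ∷ _}       (there x∈p─q) x∈q = x∈p─q⇒x∉q x∈p─q (drop-there x∈q)

x∈p-y⇒x≢y : ∀ {n} {p : Subset n} {x y} → x ∈ p - y → x ≢ y
x∈p-y⇒x≢y {y = y} x∈p-y refl = x∈p─q⇒x∉q x∈p-y (x∈⁅x⁆ y)

x∈p⇒suc∣p-x∣≡∣p∣ : ∀ {n} {p : Subset n} {x} → x ∈ p → suc ∣ p - x ∣ ≡ ∣ p ∣
x∈p⇒suc∣p-x∣≡∣p∣ {p = inside ∷ p}  here        = cong suc (cong ∣_∣ (p─⊥≡p p))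
x∈p⇒suc∣p-x∣≡∣p∣ {p = inside ∷ _}  (there x∈p) = cong suc (x∈p⇒suc∣p-x∣≡∣p∣ x∈p)
x∈p⇒suc∣p-x∣≡∣p∣ {p = outside ∷ _} (there x∈p) = x∈p⇒suc∣p-x∣≡∣p∣ x∈p

x∉p⇒∣⁅x⁆∪p∣≡suc∣p∣ : ∀ {n} {p : Subset n} {x} → x ∉ p → ∣ ⁅ x ⁆ ∪ p ∣ ≡ suc ∣ p ∣
x∉p⇒∣⁅x⁆∪p∣≡suc∣p∣ {p = inside ∷ _}  {zero}  x∉p = contradiction here x∉p
x∉p⇒∣⁅x⁆∪p∣≡suc∣p∣ {p = outside ∷ p} {zero}  _   = cong suc (cong ∣_∣ (∪-identityˡ p))
x∉p⇒∣⁅x⁆∪p∣≡suc∣p∣ {p = inside ∷ _}  {suc _} x∉p = cong suc (x∉p⇒∣⁅x⁆∪p∣≡suc∣p∣ (drop-not-there x∉p))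
x∉p⇒∣⁅x⁆∪p∣≡suc∣p∣ {p = outside ∷ _} {suc _} x∉p = x∉p⇒∣⁅x⁆∪p∣≡suc∣p∣ (drop-not-there x∉p)

-- Counting edges

𝟙 : Bool → ℕ
𝟙 b = if b then 1 else 0

𝟙-split : ∀ b c → 𝟙 (b ∧ c) + 𝟙 (b ∧ not c) ≡ 𝟙 b
𝟙-split true  true  = refl
𝟙-split true  false = refl
𝟙-split false _     = refl

module _ {A : Set} where

  sum-map-+ : ∀ (f g : A → ℕ) xs → sum (map (λ x → f x + g x) xs) ≡ sum (map f xs) + sum (map g xs)
  sum-map-+ f g []       = refl
  sum-map-+ f g (x ∷ xs) = trans (cong (f x + g x +_) (sum-map-+ f g xs))
                                 (interchange +-commutativeSemigroup (f x) (g x) _ _)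

  sum-map-𝟙≡length-filterᵇ : ∀ (p : A → Bool) xs → sum (map (𝟙 ∘ p) xs) ≡ length (filterᵇ p xs)
  sum-map-𝟙≡length-filterᵇ p []       = refl
  sum-map-𝟙≡length-filterᵇ p (x ∷ xs) with p x
  ... | true  = cong suc (sum-map-𝟙≡length-filterᵇ p xs)
  ... | false = sum-map-𝟙≡length-filterᵇ p xs

  sum-map-1≡length : ∀ (xs : List A) → sum (map (λ _ → 1) xs) ≡ length xs
  sum-map-1≡length []       = refl
  sum-map-1≡length (_ ∷ xs) = cong suc (sum-map-1≡length xs)

module _ {A B : Set} where

  sum-cartesianProduct : ∀ (f : A → B → ℕ) xs ys →
    sum (map (λ x → sum (map (f x) ys)) xs) ≡ sum (map (uncurry f) (cartesianProduct xs ys))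
  sum-cartesianProduct f []       ys = refl
  sum-cartesianProduct f (x ∷ xs) ys = begin
    sum (map (f x) ys) + sum (map (λ x → sum (map (f x) ys)) xs)
      ≡⟨ cong₂ _+_ (cong sum (map-∘ ys)) (sum-cartesianProduct f xs ys) ⟩
    sum (map (uncurry f) (map (x ,_) ys)) + sum (map (uncurry f) (cartesianProduct xs ys))
      ≡⟨ sum-++ (map (uncurry f) (map (x ,_) ys)) _ ⟨
    sum (map (uncurry f) (map (x ,_) ys) ++ map (uncurry f) (cartesianProduct xs ys))
      ≡⟨ cong sum (map-++ (uncurry f) (map (x ,_) ys) _) ⟨
    sum (map (uncurry f) (cartesianProduct (x ∷ xs) ys)) ∎
    where open ≡-Reasoning

sum-allFin-suc : ∀ {n} (f : Fin (suc n) → ℕ) →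
  sum (map f (allFin (suc n))) ≡ f zero + sum (map (f ∘ suc) (allFin n))
sum-allFin-suc f =
  cong (λ xs → f zero + sum xs) (trans (map-tabulate suc f) (sym (map-tabulate id (f ∘ suc))))

pairs-below-diagonal : ∀ n →
  sum (map (λ (i : Fin n) → sum (map (λ j → 𝟙 (toℕ i <ᵇ toℕ j)) (allFin n))) (allFin n)) ≡ n C 2
pairs-below-diagonal zero    = refl
pairs-below-diagonal (suc n) = begin
  sum (map row (allFin (suc n)))               ≡⟨ sum-allFin-suc row ⟩
  row zero + sum (map (row ∘ suc) (allFin n))  ≡⟨ cong₂ _+_ first-row other-rows ⟩
  n + n C 2                                    ≡⟨ cong (_+ n C 2) (nC1≡n n) ⟨
  n C 1 + n C 2                                ≡⟨ nCk+nC[k+1]≡[n+1]C[k+1] n 1 ⟩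
  suc n C 2                                    ∎
  where
  open ≡-Reasoning
  row : Fin (suc n) → ℕ
  row i = sum (map (λ j → 𝟙 (toℕ i <ᵇ toℕ j)) (allFin (suc n)))
  first-row : row zero ≡ n
  first-row = trans (sum-allFin-suc {n} (λ j → 𝟙 (0 <ᵇ toℕ j)))
                    (trans (sum-map-1≡length (allFin n)) (length-tabulate id))
  other-rows : sum (map (row ∘ suc) (allFin n)) ≡ n C 2
  other-rows = trans (cong sum (map-cong (λ i → sum-allFin-suc {n} (λ j → 𝟙 (suc (toℕ i) <ᵇ toℕ j)))
                                         (allFin n)))
                     (pairs-below-diagonal n)

<ᵇ-flip : ∀ m n → m ≢ n → (n <ᵇ m) ≡ not (m <ᵇ n)
<ᵇ-flip zero    zero    m≢n = contradiction refl m≢n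
<ᵇ-flip zero    (suc n) _   = refl
<ᵇ-flip (suc m) zero    _   = refl
<ᵇ-flip (suc m) (suc n) m≢n = <ᵇ-flip m n (m≢n ∘ cong suc)

module _ {n : ℕ} where

  -- An unordered pair is represented by its increasing ordering, the i < j convention of edgeCount.
  sortedPair : Fin n → Fin n → Fin n × Fin n
  sortedPair x y = if toℕ x <ᵇ toℕ y then (x , y) else (y , x)

  sortedPair-comm : ∀ {x y} → x ≢ y → sortedPair x y ≡ sortedPair y x
  sortedPair-comm {x} {y} x≢y
    rewrite <ᵇ-flip (toℕ x) (toℕ y) (x≢y ∘ toℕ-injective) with toℕ x <ᵇ toℕ y
  ... | true  = refl
  ... | false = refl

  sortedPair-injective : ∀ {x y x′ y′} → sortedPair x y ≡ sortedPair x′ y′ →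
                         (x ≡ x′ × y ≡ y′) ⊎ (x ≡ y′ × y ≡ x′)
  sortedPair-injective {x} {y} {x′} {y′} eq with toℕ x <ᵇ toℕ y | toℕ x′ <ᵇ toℕ y′
  ... | true  | true  = inj₁ (cong proj₁ eq , cong proj₂ eq)
  ... | true  | false = inj₂ (cong proj₁ eq , cong proj₂ eq)
  ... | false | true  = inj₂ (cong proj₂ eq , cong proj₁ eq)
  ... | false | false = inj₁ (cong proj₂ eq , cong proj₁ eq)

  sortedPair-of-below : ∀ {i j} → T (toℕ i <ᵇ toℕ j) → sortedPair i j ≡ (i , j)
  sortedPair-of-below {i} {j} i<j with toℕ i <ᵇ toℕ j
  ... | true = refl

  allPairs : List (Fin n × Fin n)
  allPairs = cartesianProduct (allFin n) (allFin n)

  below : Fin n × Fin n → Bool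
  below (i , j) = toℕ i <ᵇ toℕ j

  module _ (G : Graph n) where

    isEdge isNonEdge : Fin n × Fin n → Bool
    isEdge    (i , j) = below (i , j) ∧ adj G i j
    isNonEdge (i , j) = below (i , j) ∧ not (adj G i j)

    nonEdges : List (Fin n × Fin n)
    nonEdges = filterᵇ isNonEdge allPairs

    nonEdges-unique : Unique nonEdges
    nonEdges-unique = Unique.filter⁺ _ (Unique.cartesianProduct⁺ (Unique.allFin⁺ n) (Unique.allFin⁺ n))

    edgeCount+|nonEdges|≡nC2 : edgeCount G + length nonEdges ≡ n C 2
    edgeCount+|nonEdges|≡nC2 = begin
      edgeCount G + length nonEdges
        ≡⟨ cong₂ _+_ (sum-cartesianProduct (λ i j → 𝟙 (isEdge (i , j))) (allFin n) (allFin n))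
                     (sym (sum-map-𝟙≡length-filterᵇ isNonEdge allPairs)) ⟩
      sum (map (𝟙 ∘ isEdge) allPairs) + sum (map (𝟙 ∘ isNonEdge) allPairs)
        ≡⟨ sum-map-+ (𝟙 ∘ isEdge) (𝟙 ∘ isNonEdge) allPairs ⟨
      sum (map (λ p → 𝟙 (isEdge p) + 𝟙 (isNonEdge p)) allPairs)
        ≡⟨ cong sum (map-cong (λ (i , j) → 𝟙-split (below (i , j)) (adj G i j)) allPairs) ⟩
      sum (map (𝟙 ∘ below) allPairs)
        ≡⟨ sum-cartesianProduct (λ i j → 𝟙 (below (i , j))) (allFin n) (allFin n) ⟨
      sum (map (λ i → sum (map (λ j → 𝟙 (toℕ i <ᵇ toℕ j)) (allFin n))) (allFin n))
        ≡⟨ pairs-below-diagonal n ⟩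
      n C 2 ∎
      where open ≡-Reasoning

    edgeCount+suc|nonEdges|≡nC2+1 : edgeCount G + suc (length nonEdges) ≡ n C 2 + 1
    edgeCount+suc|nonEdges|≡nC2+1 = begin
      edgeCount G + suc (length nonEdges)  ≡⟨ +-suc (edgeCount G) _ ⟩
      suc (edgeCount G + length nonEdges)  ≡⟨ cong suc edgeCount+|nonEdges|≡nC2 ⟩
      suc (n C 2)                          ≡⟨ +-comm 1 (n C 2) ⟩
      n C 2 + 1                            ∎
      where open ≡-Reasoning

    sortedPair∈nonEdges : ∀ {x y} → x ≢ y → adj G x y ≡ false → sortedPair x y ∈ᴸ nonEdges
    sortedPair∈nonEdges {x} {y} x≢y x≁y with toℕ x <ᵇ toℕ y in x<y
    ... | true  = ∈-filter⁺ _ (∈-cartesianProduct⁺ (∈-allFin x) (∈-allFin y))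
                    (Equivalence.from T-∧ (subst T (sym x<y) _ , Equivalence.from T-not-≡ x≁y))
    ... | false = ∈-filter⁺ _ (∈-cartesianProduct⁺ (∈-allFin y) (∈-allFin x))
                    (Equivalence.from T-∧ (subst T (sym y<x) _ , Equivalence.from T-not-≡ y≁x))
      where
      y<x : (toℕ y <ᵇ toℕ x) ≡ true
      y<x = trans (<ᵇ-flip (toℕ x) (toℕ y) (x≢y ∘ toℕ-injective)) (cong not x<y)
      y≁x : adj G y x ≡ false
      y≁x = trans (adj-sym G y x) x≁y

    ∈-nonEdges⁻ : ∀ {i j} → (i , j) ∈ᴸ nonEdges → i ≢ j × adj G i j ≡ false × sortedPair i j ≡ (i , j)
    ∈-nonEdges⁻ {i} {j} ij∈ with Equivalence.to T-∧ (proj₂ (∈-filter⁻ _ {xs = allPairs} ij∈))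
    ... | i<j , i≁j = i≢j , Equivalence.to T-not-≡ i≁j , sortedPair-of-below i<j
      where
      i≢j : i ≢ j
      i≢j refl = <-irrefl refl (<ᵇ⇒< (toℕ i) (toℕ i) i<j)

-- Walks and general position

module _ {n : ℕ} (G : Graph n) where

  adj-flip : ∀ {x y b} → adj G x y ≡ b → adj G y x ≡ b
  adj-flip {x} {y} x~y = trans (adj-sym G y x) x~y

  adjacent⇒≢ : ∀ {x y} → adj G x y ≡ true → x ≢ y
  adjacent⇒≢ {x} x~x refl with () ← trans (sym x~x) (adj-irrefl G x)

  NoInducedP₃ : Subset n → Set
  NoInducedP₃ S = ∀ {a c b} → a ∈ S → c ∈ S → b ∈ S → a ≢ b →
                  adj G a c ≡ true → adj G c b ≡ true → adj G a b ≡ false → ⊥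

  Diameter≤2 : Set
  Diameter≤2 = ∀ u v → Σ (Walk G u v) λ w → len w ≤ 2

  vertices : ∀ {u v} → Walk G u v → List (Fin n)
  vertices (here u)       = u ∷ []
  vertices (step {u} _ w) = u ∷ vertices w

  onWalk⇒∈vertices : ∀ {x u v} (w : Walk G u v) → OnWalk x w → x ∈ᴸ vertices w
  onWalk⇒∈vertices (here _)   refl        = here refl
  onWalk⇒∈vertices (step _ w) (inj₁ refl) = here refl
  onWalk⇒∈vertices (step _ w) (inj₂ x∈w)  = there (onWalk⇒∈vertices w x∈w)

  gp⇒noInducedP₃ : ∀ {S} → GeneralPosition G S → NoInducedP₃ S
  gp⇒noInducedP₃ gp {a} {c} {b} a∈S c∈S b∈S a≢b a~c c~b a≁b =
    gp a b a-c-b a-c-b-shortest a c b a∈S c∈S b∈S (adjacent⇒≢ a~c) a≢b (adjacent⇒≢ c~b)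
       (inj₁ refl) (inj₂ (inj₁ refl)) (inj₂ (inj₂ refl))
    where
    a-c-b = step a~c (step c~b (here b))
    a-c-b-shortest : Shortest a-c-b
    a-c-b-shortest (here _)            = contradiction refl a≢b
    a-c-b-shortest (step a~b (here _)) with () ← trans (sym a~b) a≁b
    a-c-b-shortest (step _ (step _ _)) = s≤s (s≤s z≤n)

  noInducedP₃⇒gp : ∀ {S} → Diameter≤2 → NoInducedP₃ S → GeneralPosition G S
  noInducedP₃⇒gp {S} diam noP₃ u v w w-shortest x y z x∈S y∈S z∈S x≢y x≢z y≢z x∈w y∈w z∈w =
    triple-on w w-shortest (≤-trans (w-shortest (proj₁ (diam u v))) (proj₂ (diam u v))) xyz⊆w
    where
    xyz = x ∷ y ∷ z ∷ []
    xyz! = distinct₃ x≢y x≢z y≢z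
    xyz⊆S : All.All (_∈ S) xyz
    xyz⊆S = x∈S All.∷ y∈S All.∷ z∈S All.∷ All.[]
    xyz⊆w : xyz ⊆ᴸ vertices w
    xyz⊆w (here refl)                 = onWalk⇒∈vertices w x∈w
    xyz⊆w (there (here refl))         = onWalk⇒∈vertices w y∈w
    xyz⊆w (there (there (here refl))) = onWalk⇒∈vertices w z∈w
    triple-on : ∀ {v} (w : Walk G u v) → Shortest w → len w ≤ 2 → xyz ⊆ᴸ vertices w → ⊥
    triple-on (here _) _ _ xyz⊆w =
      contradiction (unique∧xs⊆ys⇒|xs|≤|ys| xyz! xyz⊆w) λ where (s≤s ())
    triple-on (step _ (here _)) _ _ xyz⊆w =
      contradiction (unique∧xs⊆ys⇒|xs|≤|ys| xyz! xyz⊆w) λ where (s≤s (s≤s ()))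
    triple-on (step _ (step _ (step _ _))) _ (s≤s (s≤s ())) _
    triple-on {v} (step {w = m} u~m (step m~v (here _))) shortest _ xyz⊆w =
      noP₃ (in-S (here refl)) (in-S (there (here refl))) (in-S (there (there (here refl))))
           u≢v u~m m~v u≁v
      where
      in-S : ∀ {t} → t ∈ᴸ u ∷ m ∷ v ∷ [] → t ∈ S
      in-S t∈ = All.lookup xyz⊆S (unique∧xs⊆ys∧|ys|≤|xs|⇒ys⊆xs _≟_ xyz! xyz⊆w ≤-refl t∈)
      u≢v : u ≢ v
      u≢v refl with () ← shortest (here u)
      u≁v : adj G u v ≡ false
      u≁v with adj G u v in u~v
      ... | false = refl
      ... | true  with s≤s () ← shortest (step u~v (here v))

  commonNeighbour⇒diameter≤2 :
    (∀ x y → x ≢ y → adj G x y ≡ false → ∃ λ c → adj G x c ≡ true × adj G c y ≡ true) → Diameter≤2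
  commonNeighbour⇒diameter≤2 common x y with x ≟ y
  ... | yes refl = here x , z≤n
  ... | no x≢y with adj G x y in x~y
  ...   | true  = step x~y (here y) , s≤s z≤n
  ...   | false with common x y x≢y x~y
  ...     | c , x~c , c~y = step x~c (step c~y (here y)) , ≤-refl

  maximal-closed : ∀ {S x} → MaximalGP G S → (x ∉ S → GeneralPosition G (S ∪ ⁅ x ⁆)) → x ∈ S
  maximal-closed {S} {x} (_ , maximal) extends with x ∈? S
  ... | yes x∈S = x∈S
  ... | no  x∉S = contradiction (extends x∉S)
                    (maximal (S ∪ ⁅ x ⁆) (p⊆p∪q ⁅ x ⁆ , x , x∈p∪q⁺ (inj₂ (x∈⁅x⁆ x)) , x∉S))

  gp-⁅⁆∪⁅⁆ : ∀ a b → GeneralPosition G (⁅ a ⁆ ∪ ⁅ b ⁆)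
  gp-⁅⁆∪⁅⁆ a b _ _ _ _ x y z x∈ y∈ z∈ x≢y x≢z y≢z _ _ _ =
    contradiction (unique∧xs⊆ys⇒|xs|≤|ys| (distinct₃ x≢y x≢z y≢z) xyz⊆ab) λ where (s≤s (s≤s ()))
    where
    in-ab : ∀ {t} → t ∈ ⁅ a ⁆ ∪ ⁅ b ⁆ → t ∈ᴸ a ∷ b ∷ []
    in-ab t∈ with x∈p∪q⁻ ⁅ a ⁆ ⁅ b ⁆ t∈
    ... | inj₁ t∈⁅a⁆ = here (x∈⁅y⁆⇒x≡y a t∈⁅a⁆)
    ... | inj₂ t∈⁅b⁆ = there (here (x∈⁅y⁆⇒x≡y b t∈⁅b⁆))
    xyz⊆ab : x ∷ y ∷ z ∷ [] ⊆ᴸ a ∷ b ∷ []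
    xyz⊆ab (here refl)                 = in-ab x∈
    xyz⊆ab (there (here refl))         = in-ab y∈
    xyz⊆ab (there (there (here refl))) = in-ab z∈

  module _ (complete : ∀ x y → x ≢ y → adj G x y ≡ true) where

    complete⇒gp : ∀ T → GeneralPosition G T
    complete⇒gp T = noInducedP₃⇒gp
      (commonNeighbour⇒diameter≤2 λ x y x≢y x≁y → contradiction (trans (sym (complete x y x≢y)) x≁y) λ ())
      λ _ _ _ a≢b _ _ a≁b → contradiction (trans (sym (complete _ _ a≢b)) a≁b) λ ()

    complete⇒gp⁻≡n : ∀ {k} → GpMinusIs G k → k ≡ n
    complete⇒gp⁻≡n {k} ((S , maxS , ∣S∣≡k) , _) = begin
      k          ≡⟨ ∣S∣≡k ⟨
      ∣ S ∣      ≡⟨ cong ∣_∣ (⊆-antisym (λ _ → ∈⊤) λ _ → maximal-closed maxS λ _ → complete⇒gp _) ⟩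
      ∣ ⊤ {n} ∣  ≡⟨ ∣⊤∣≡n n ⟩
      n          ∎
      where open ≡-Reasoning

  MaximalAbove : Subset n → Set
  MaximalAbove S = ∃ λ T → S ⊆ T × MaximalGP G T

  -- General position quantifies over all walks and is not decidable, so a maximal extension is only
  -- obtained under double negation; this suffices because the conclusions drawn from it are decidable.
  extend-to-maximal : ∀ S → GeneralPosition G S → ¬ ¬ MaximalAbove S
  extend-to-maximal S = go (⊃-wellFounded S)
    where
    open RawMonad (¬¬-Monad {0ℓ})
    go : ∀ {S} → Acc _⊃_ S → GeneralPosition G S → ¬ ¬ MaximalAbove S
    go {S} (acc larger) gpS = ¬¬-excluded-middle {A = ∃ λ T → S ⊂ T × GeneralPosition G T} >>= λ where
        (yes (T , S⊂T , gpT)) → ¬¬-map (above S⊂T) (go (larger S⊂T) gpT)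
        (no  ¬larger)         → pure (S-maximal ¬larger)
      where
      above : ∀ {T} → S ⊂ T → MaximalAbove T → MaximalAbove S
      above S⊂T (U , T⊆U , maxU) = U , ⊆-trans (p⊂q⇒p⊆q S⊂T) T⊆U , maxU
      S-maximal : ¬ (∃ λ T → S ⊂ T × GeneralPosition G T) → MaximalAbove S
      S-maximal ¬larger = S , ⊆-refl , gpS , λ T S⊂T gpT → ¬larger (T , S⊂T , gpT)

-- Complete graphs minus a star

StarPair : ∀ {n} → Fin n → Subset n → Fin n → Fin n → Set
StarPair v D x y = (x ≡ v × y ∈ D) ⊎ (y ≡ v × x ∈ D)

module _ {n : ℕ} {v : Fin n} {D : Subset n} where

  starPair-sym : ∀ {x y} → StarPair v D x y → StarPair v D y x
  starPair-sym (inj₁ p) = inj₂ p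
  starPair-sym (inj₂ p) = inj₁ p

  starPair? : ∀ x y → Dec (StarPair v D x y)
  starPair? x y = (x ≟ v ×-dec y ∈? D) ⊎-dec (y ≟ v ×-dec x ∈? D)

module DeleteStarProperties {n : ℕ} (v : Fin n) (D : Subset n) where

  private
    ∉⇒lookup≡false : ∀ {x} → x ∉ D → lookup D x ≡ false
    ∉⇒lookup≡false {x} x∉D with lookup D x in eq
    ... | true  = contradiction (lookup⇒[]= x D eq) x∉D
    ... | false = refl

    centre≁leaf : ∀ {d} → d ∈ D → adj (deleteStar v D) v d ≡ false
    centre≁leaf {d} d∈D rewrite []=⇒lookup d∈D with v ≟ d | v ≟ v
    ... | yes _ | _      = refl
    ... | no _  | yes _  = refl
    ... | no _  | no v≢v = contradiction refl v≢v

  deleteStar-starPair : ∀ {x y} → StarPair v D x y → adj (deleteStar v D) x y ≡ false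
  deleteStar-starPair (inj₁ (refl , y∈D)) = centre≁leaf y∈D
  deleteStar-starPair (inj₂ (refl , x∈D)) = adj-flip (deleteStar v D) {v} (centre≁leaf x∈D)

  deleteStar-adjacent : ∀ {x y} → x ≢ y → ¬ StarPair v D x y → adj (deleteStar v D) x y ≡ true
  deleteStar-adjacent {x} {y} x≢y ¬xy with x ≟ y
  ... | yes x≡y = contradiction x≡y x≢y
  ... | no _ with x ≟ v | y ≟ v
  ...   | no _    | no _    = refl
  ...   | yes x≡v | yes y≡v = contradiction (trans x≡v (sym y≡v)) x≢y
  ...   | yes x≡v | no _    rewrite ∉⇒lookup≡false (λ y∈D → ¬xy (inj₁ (x≡v , y∈D))) = refl
  ...   | no _    | yes y≡v rewrite ∉⇒lookup≡false (λ x∈D → ¬xy (inj₂ (y≡v , x∈D))) = refl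

  deleteStar-nonadjacent : ∀ {x y} → x ≢ y → adj (deleteStar v D) x y ≡ false → StarPair v D x y
  deleteStar-nonadjacent {x} {y} x≢y x≁y with starPair? x y
  ... | yes xy = xy
  ... | no ¬xy with () ← trans (sym (deleteStar-adjacent x≢y ¬xy)) x≁y

  starPairs⇒SameGraph : (G : Graph n) →
    (∀ x y → x ≢ y → adj G x y ≡ false → StarPair v D x y) →
    (∀ {d} → d ∈ D → adj G v d ≡ false) → SameGraph G (deleteStar v D)
  starPairs⇒SameGraph G nonadjacent⇒starPair v≁D x y with adj G x y in x~y
  ... | true  = sym (deleteStar-adjacent (adjacent⇒≢ G x~y) λ xy →
                  contradiction (trans (sym x~y) (starPair⇒nonadjacent xy)) λ ())
    where
    starPair⇒nonadjacent : StarPair v D x y → adj G x y ≡ false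
    starPair⇒nonadjacent (inj₁ (refl , y∈D)) = v≁D y∈D
    starPair⇒nonadjacent (inj₂ (refl , x∈D)) = adj-flip G (v≁D x∈D)
  ... | false = sym (equal-or-starPair (x ≟ y))
    where
    equal-or-starPair : Dec (x ≡ y) → adj (deleteStar v D) x y ≡ false
    equal-or-starPair (yes refl) = adj-irrefl (deleteStar v D) x
    equal-or-starPair (no x≢y)   = deleteStar-starPair (nonadjacent⇒starPair x y x≢y x~y)

-- The spokes of a general position set

module Spokes {n : ℕ} (G : Graph n) {S : Subset n} {a b : Fin n}
              (gp : GeneralPosition G S) (a∈S : a ∈ S) (b∈S : b ∈ S)
              (a≢b : a ≢ b) (a≁b : adj G a b ≡ false) where

  partner : Fin n → Fin n
  partner s = if adj G s a then b else a

  partner-of-≁ : ∀ {s} → adj G s a ≡ false → partner s ≡ a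
  partner-of-≁ s≁a rewrite s≁a = refl

  partner-of-~ : ∀ {s} → adj G s a ≡ true → partner s ≡ b
  partner-of-~ s~a rewrite s~a = refl

  partner∈ab : ∀ s → partner s ≡ a ⊎ partner s ≡ b
  partner∈ab s with adj G s a
  ... | true  = inj₂ refl
  ... | false = inj₁ refl

  partner-a : partner a ≡ a
  partner-a = partner-of-≁ (adj-irrefl G a)

  partner-b : partner b ≡ a
  partner-b = partner-of-≁ (adj-flip G a≁b)

  partner-nonadjacent : ∀ {s} → s ∈ S → s ≢ a → adj G s (partner s) ≡ false
  partner-nonadjacent {s} s∈S s≢a with adj G s a in s~a
  ... | false = s~a
  ... | true  with adj G s b in s~b
  ...   | false = refl
  ...   | true  = contradiction (adj-flip G s~a) λ a~s → gp⇒noInducedP₃ G gp a∈S s∈S b∈S a≢b a~s s~b a≁b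

  partner-≢ : ∀ {s} → s ≢ a → s ≢ partner s
  partner-≢ {s} s≢a with adj G s a in s~a
  ... | false = s≢a
  ... | true  = λ where refl → contradiction (trans (sym s~a) (adj-flip G a≁b)) λ ()

  partner-fixed : ∀ {t} → partner (partner t) ≡ t → partner t ≡ t
  partner-fixed {t} ppt≡t with partner∈ab t
  ... | inj₁ pt≡a = trans pt≡a (sym (trans (sym ppt≡t) (trans (cong partner pt≡a) partner-a)))
  ... | inj₂ pt≡b = contradiction (trans (sym partner-a) (trans (cong partner (sym t≡a)) pt≡b)) a≢b
    where
    t≡a : t ≡ a
    t≡a = trans (sym ppt≡t) (trans (cong partner pt≡b) partner-b)

  spoke : Fin n → Fin n × Fin n
  spoke s = sortedPair s (partner s)

  spoke-injective : ∀ {s t} → spoke s ≡ spoke t → s ≡ t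
  spoke-injective eq with sortedPair-injective eq
  ... | inj₁ (s≡t , _)     = s≡t
  ... | inj₂ (s≡pt , ps≡t) = trans s≡pt (partner-fixed (trans (cong partner (sym s≡pt)) ps≡t))

  spokes : List (Fin n × Fin n)
  spokes = map spoke (elements (S - a))

  spokes-unique : Unique spokes
  spokes-unique = Unique.map⁺ spoke-injective (elements-unique (S - a))

  ∈-elements[S-a]⁻ : ∀ {s} → s ∈ᴸ elements (S - a) → s ∈ S × s ≢ a
  ∈-elements[S-a]⁻ s∈ = p─q⊆p S _ (∈-elements⁻ s∈) , x∈p-y⇒x≢y {p = S} (∈-elements⁻ s∈)

  spokes⊆nonEdges : spokes ⊆ᴸ nonEdges G
  spokes⊆nonEdges p∈ with ∈-map⁻ spoke p∈
  ... | s , s∈ , refl with ∈-elements[S-a]⁻ s∈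
  ...   | s∈S , s≢a = sortedPair∈nonEdges G (partner-≢ s≢a) (partner-nonadjacent s∈S s≢a)

  suc-length-spokes : suc (length spokes) ≡ ∣ S ∣
  suc-length-spokes = begin
    suc (length spokes)              ≡⟨ cong suc (length-map spoke (elements (S - a))) ⟩
    suc (length (elements (S - a)))  ≡⟨ cong suc (length-elements (S - a)) ⟩
    suc ∣ S - a ∣                    ≡⟨ x∈p⇒suc∣p-x∣≡∣p∣ a∈S ⟩
    ∣ S ∣                            ∎
    where open ≡-Reasoning

  ∣S∣≤suc-length-nonEdges : ∣ S ∣ ≤ suc (length (nonEdges G))
  ∣S∣≤suc-length-nonEdges = subst (_≤ suc (length (nonEdges G))) suc-length-spokes
    (s≤s (unique∧xs⊆ys⇒|xs|≤|ys| spokes-unique spokes⊆nonEdges))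

  module _ (covered : nonEdges G ⊆ᴸ spokes) where

    nonadjacent⇒spoke : ∀ {x y} → x ≢ y → adj G x y ≡ false →
      ∃ λ s → s ∈ S × s ≢ a × ((x ≡ s × y ≡ partner s) ⊎ (x ≡ partner s × y ≡ s))
    nonadjacent⇒spoke x≢y x≁y with ∈-map⁻ spoke (covered (sortedPair∈nonEdges G x≢y x≁y))
    ... | s , s∈ , eq with ∈-elements[S-a]⁻ s∈
    ...   | s∈S , s≢a = s , s∈S , s≢a , sortedPair-injective eq

    nonadjacent⇒touches-ab : ∀ {x y} → x ≢ y → adj G x y ≡ false → (x ≡ a ⊎ x ≡ b) ⊎ (y ≡ a ⊎ y ≡ b)
    nonadjacent⇒touches-ab x≢y x≁y with nonadjacent⇒spoke x≢y x≁y
    ... | s , _ , _ , inj₁ (_ , refl) = inj₂ (partner∈ab s)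
    ... | s , _ , _ , inj₂ (refl , _) = inj₁ (partner∈ab s)

    Centre : Fin n → Set
    Centre c = (c ≡ a ⊎ c ≡ b) × (∀ {s} → s ∈ S → s ≢ a → s ≢ c → partner s ≡ c)

    -- Every non-edge is a spoke and so touches a or b; hence vertices s, t ∉ {a, b} with partners a
    -- and b are adjacent, and a – t – s is an induced path in S.
    centre : ∃ Centre
    centre with any? (λ s → s ∈? S ×-dec ¬? (s ≟ a) ×-dec ¬? (s ≟ b) ×-dec (adj G s a ≟ᵇ false))
    ... | yes (s₀ , s₀∈S , s₀≢a , s₀≢b , s₀≁a) = a , inj₁ refl , λ s∈S s≢a _ → partner≡a s∈S s≢a
      where
      partner≡a : ∀ {s} → s ∈ S → s ≢ a → partner s ≡ a
      partner≡a {s} s∈S s≢a with adj G s a in s~a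
      ... | false = refl
      ... | true  = contradiction s~s₀ λ s~s₀ →
                      gp⇒noInducedP₃ G gp a∈S s∈S s₀∈S (λ where refl → s₀≢a refl)
                        (adj-flip G s~a) s~s₀ (adj-flip G s₀≁a)
        where
        s≢b : s ≢ b
        s≢b refl = contradiction (trans (sym s~a) (adj-flip G a≁b)) λ ()
        s≢s₀ : s ≢ s₀
        s≢s₀ refl = contradiction (trans (sym s~a) s₀≁a) λ ()
        s~s₀ : adj G s s₀ ≡ true
        s~s₀ with adj G s s₀ in s≁s₀
        ... | true  = refl
        ... | false with nonadjacent⇒touches-ab s≢s₀ s≁s₀
        ...   | inj₁ (inj₁ s≡a)  = contradiction s≡a s≢a
        ...   | inj₁ (inj₂ s≡b)  = contradiction s≡b s≢b
        ...   | inj₂ (inj₁ s₀≡a) = contradiction s₀≡a s₀≢a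
        ...   | inj₂ (inj₂ s₀≡b) = contradiction s₀≡b s₀≢b
    ... | no ¬s₀ = b , inj₂ refl , λ s∈S s≢a s≢b → partner-of-~ (s~a s∈S s≢a s≢b)
      where
      s~a : ∀ {s} → s ∈ S → s ≢ a → s ≢ b → adj G s a ≡ true
      s~a {s} s∈S s≢a s≢b with adj G s a in s~a
      ... | true  = refl
      ... | false = contradiction (s , s∈S , s≢a , s≢b , s~a) ¬s₀

    module _ {c} (centre-c : Centre c) where

      private
        partner≡c = proj₂ centre-c

        c≢a⇒c≡b : c ≢ a → c ≡ b
        c≢a⇒c≡b c≢a with proj₁ centre-c
        ... | inj₁ c≡a = contradiction c≡a c≢a
        ... | inj₂ c≡b = c≡b

      c∈S : c ∈ S
      c∈S with proj₁ centre-c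
      ... | inj₁ refl = a∈S
      ... | inj₂ refl = b∈S

      spoke-starPair : ∀ {s} → s ∈ S → s ≢ a → StarPair c (S - c) s (partner s)
      spoke-starPair {s} s∈S s≢a with s ≟ c
      ... | no s≢c   = inj₂ (partner≡c s∈S s≢a s≢c , x∈p∧x≢y⇒x∈p-y s∈S s≢c)
      ... | yes refl = inj₁ (refl , subst (_∈ S - c) (sym partner-c≡a) (x∈p∧x≢y⇒x∈p-y a∈S a≢c))
        where
        c≡b = c≢a⇒c≡b s≢a
        partner-c≡a : partner c ≡ a
        partner-c≡a = trans (cong partner c≡b) partner-b
        a≢c : a ≢ c
        a≢c a≡c = a≢b (trans a≡c c≡b)

      nonadjacent⇒starPair : ∀ x y → x ≢ y → adj G x y ≡ false → StarPair c (S - c) x y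
      nonadjacent⇒starPair x y x≢y x≁y with nonadjacent⇒spoke x≢y x≁y
      ... | s , s∈S , s≢a , inj₁ (refl , refl) = spoke-starPair s∈S s≢a
      ... | s , s∈S , s≢a , inj₂ (refl , refl) = starPair-sym (spoke-starPair s∈S s≢a)

      centre-nonadjacent : ∀ {d} → d ∈ S - c → adj G c d ≡ false
      centre-nonadjacent {d} d∈S-c = by-cases (d ≟ a)
        where
        d∈S = p─q⊆p S _ d∈S-c
        d≢c = x∈p-y⇒x≢y {p = S} d∈S-c
        by-cases : Dec (d ≡ a) → adj G c d ≡ false
        by-cases (yes refl) = subst (λ c → adj G c d ≡ false) (sym (c≢a⇒c≡b λ c≡d → d≢c (sym c≡d)))
                                    (adj-flip G a≁b)
        by-cases (no d≢a)   = adj-flip G (subst (λ p → adj G d p ≡ false) (partner≡c d∈S d≢a d≢c)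
                                                (partner-nonadjacent d∈S d≢a))

      centre⇒SameGraph : SameGraph G (deleteStar c (S - c))
      centre⇒SameGraph =
        DeleteStarProperties.starPairs⇒SameGraph c (S - c) G nonadjacent⇒starPair centre-nonadjacent

-- General position in a complete graph minus a star

starVertices : ∀ {n} → Fin n → Subset n → Subset n
starVertices v D = ⁅ v ⁆ ∪ D

module _ {n : ℕ} {v : Fin n} {D : Subset n} where

  open DeleteStarProperties v D

  centre∈starVertices : v ∈ starVertices v D
  centre∈starVertices = x∈p∪q⁺ (inj₁ (x∈⁅x⁆ v))

  ∈starVertices⁺ : ∀ {d} → d ∈ D → d ∈ starVertices v D
  ∈starVertices⁺ d∈D = x∈p∪q⁺ (inj₂ d∈D)

  ∈starVertices⁻ : ∀ {x} → x ∈ starVertices v D → x ≡ v ⊎ x ∈ D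
  ∈starVertices⁻ x∈ with x∈p∪q⁻ ⁅ v ⁆ D x∈
  ... | inj₁ x∈⁅v⁆ = inj₁ (x∈⁅y⁆⇒x≡y v x∈⁅v⁆)
  ... | inj₂ x∈D   = inj₂ x∈D

  starPair⇒∈starVertices : ∀ {x y} → StarPair v D x y → x ∈ starVertices v D
  starPair⇒∈starVertices (inj₁ (refl , _)) = centre∈starVertices
  starPair⇒∈starVertices (inj₂ (_ , x∈D))  = ∈starVertices⁺ x∈D

  outside-adjacent : ∀ {r x} → r ∉ starVertices v D → x ≢ r → adj (deleteStar v D) r x ≡ true
  outside-adjacent r∉ x≢r =
    deleteStar-adjacent (λ r≡x → x≢r (sym r≡x)) λ rx → r∉ (starPair⇒∈starVertices rx)

  centre-neighbour⇒outside : ∀ {c} → adj (deleteStar v D) v c ≡ true → c ∉ starVertices v D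
  centre-neighbour⇒outside {c} v~c c∈ with ∈starVertices⁻ c∈
  ... | inj₁ refl = adjacent⇒≢ (deleteStar v D) {v} {c} v~c refl
  ... | inj₂ c∈D  = contradiction (trans (sym v~c) (deleteStar-starPair (inj₁ (refl , c∈D)))) λ ()

  deleteStar-diameter≤2 : ∀ {r} → r ∉ starVertices v D → Diameter≤2 (deleteStar v D)
  deleteStar-diameter≤2 {r} r∉ = commonNeighbour⇒diameter≤2 (deleteStar v D) λ x y x≢y x≁y →
    let xy = deleteStar-nonadjacent x≢y x≁y in
    r , adj-flip (deleteStar v D) {r} {x} (outside-adjacent r∉ (≢r (starPair⇒∈starVertices xy)))
      , outside-adjacent {x = y} r∉ (≢r (starPair⇒∈starVertices (starPair-sym xy)))
    where
    ≢r : ∀ {x} → x ∈ starVertices v D → x ≢ r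
    ≢r x∈ refl = r∉ x∈

  Obstruction : Subset n → Set
  Obstruction T = ∃ λ d → ∃ λ r → v ∈ T × d ∈ T × r ∈ T × d ∈ D × r ∉ starVertices v D

  module _ (v∉D : v ∉ D) where

    obstruction⇒¬gp : ∀ {T} → Obstruction T → ¬ GeneralPosition (deleteStar v D) T
    obstruction⇒¬gp (d , r , v∈T , d∈T , r∈T , d∈D , r∉) gp =
      gp⇒noInducedP₃ (deleteStar v D) gp v∈T r∈T d∈T (λ where refl → v∉D d∈D)
        (adj-flip (deleteStar v D) {r} {v} (outside-adjacent r∉ λ where refl → r∉ centre∈starVertices))
        (outside-adjacent r∉ λ where refl → r∉ (∈starVertices⁺ d∈D))
        (deleteStar-starPair (inj₁ (refl , d∈D)))

    ¬obstruction⇒gp : ∀ {r₀ T} → r₀ ∉ starVertices v D → ¬ Obstruction T →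
                      GeneralPosition (deleteStar v D) T
    ¬obstruction⇒gp r₀∉ ¬obs = noInducedP₃⇒gp (deleteStar v D) (deleteStar-diameter≤2 r₀∉)
      λ {a} {c} {b} a∈T c∈T b∈T a≢b a~c c~b a≁b → case deleteStar-nonadjacent a≢b a≁b of λ where
        (inj₁ (refl , b∈D)) → ¬obs (b , c , a∈T , b∈T , c∈T , b∈D , centre-neighbour⇒outside a~c)
        (inj₂ (refl , a∈D)) → ¬obs (a , c , b∈T , a∈T , c∈T , a∈D ,
                                     centre-neighbour⇒outside (adj-flip (deleteStar v D) {c} {v} c~b))

    length-nonEdges-deleteStar : length (nonEdges (deleteStar v D)) ≡ ∣ D ∣
    length-nonEdges-deleteStar = trans
      (≤-antisym (unique∧xs⊆ys⇒|xs|≤|ys| (nonEdges-unique (deleteStar v D)) nonEdges⊆deleted)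
                 (unique∧xs⊆ys⇒|xs|≤|ys| deleted-unique deleted⊆nonEdges))
      (trans (length-map (sortedPair v) (elements D)) (length-elements D))
      where
      deleted = map (sortedPair v) (elements D)
      deleted-unique : Unique deleted
      deleted-unique = Unique.map⁺ sortedPair-centre-injective (elements-unique D)
        where
        sortedPair-centre-injective : ∀ {d d′} → sortedPair v d ≡ sortedPair v d′ → d ≡ d′
        sortedPair-centre-injective eq with sortedPair-injective eq
        ... | inj₁ (_ , d≡d′)   = d≡d′
        ... | inj₂ (v≡d′ , d≡v) = trans d≡v v≡d′
      deleted⊆nonEdges : deleted ⊆ᴸ nonEdges (deleteStar v D)
      deleted⊆nonEdges p∈ with ∈-map⁻ (sortedPair v) p∈
      ... | d , d∈ , refl = sortedPair∈nonEdges (deleteStar v D) (λ where refl → v∉D (∈-elements⁻ d∈))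
                              (deleteStar-starPair (inj₁ (refl , ∈-elements⁻ d∈)))
      nonEdges⊆deleted : nonEdges (deleteStar v D) ⊆ᴸ deleted
      nonEdges⊆deleted {i , j} ij∈ with ∈-nonEdges⁻ (deleteStar v D) ij∈
      ... | i≢j , i≁j , sorted with deleteStar-nonadjacent i≢j i≁j
      ...   | inj₁ (refl , j∈D) = subst (_∈ᴸ deleted) sorted (∈-map⁺ (sortedPair v) (∈-elements⁺ j∈D))
      ...   | inj₂ (refl , i∈D) = subst (_∈ᴸ deleted) (trans (sortedPair-comm λ where refl → i≢j refl) sorted)
                                    (∈-map⁺ (sortedPair v) (∈-elements⁺ i∈D))

    edgeCount-deleteStar : edgeCount (deleteStar v D) + suc ∣ D ∣ ≡ n C 2 + 1
    edgeCount-deleteStar =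
      trans (cong (λ m → edgeCount (deleteStar v D) + suc m) (sym length-nonEdges-deleteStar))
            (edgeCount+suc|nonEdges|≡nC2+1 (deleteStar v D))

    module _ (1≤∣D∣ : 1 ≤ ∣ D ∣) (room : suc ∣ D ∣ + ∣ D ∣ ≤ n) where

      private
        ∣D∣<n∸∣D∣ : suc ∣ D ∣ ≤ n ∸ ∣ D ∣
        ∣D∣<n∸∣D∣ = m+n≤o⇒m≤o∸n (suc ∣ D ∣) room

        ∣D∣<n∸1 : suc ∣ D ∣ ≤ n ∸ 1
        ∣D∣<n∸1 = ≤-trans ∣D∣<n∸∣D∣ (∸-monoʳ-≤ n 1≤∣D∣)

        ∣∁⁅v⁆∣ : ∣ ∁ ⁅ v ⁆ ∣ ≡ n ∸ 1
        ∣∁⁅v⁆∣ = trans (∣∁p∣≡n∸∣p∣ ⁅ v ⁆) (cong (n ∸_) (∣⁅x⁆∣≡1 v))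

        ∣starVertices∣ : ∣ starVertices v D ∣ ≡ suc ∣ D ∣
        ∣starVertices∣ = x∉p⇒∣⁅x⁆∪p∣≡suc∣p∣ v∉D

      outside-vertex : ∃ λ r → r ∉ starVertices v D
      outside-vertex with any? (λ r → ¬? (r ∈? starVertices v D))
      ... | yes r∉ = r∉
      ... | no ¬r∉ = contradiction (≤-trans room′ n≤∣starVertices∣) 1+n≰n
        where
        all-in : ⊤ ⊆ starVertices v D
        all-in {x} _ with x ∈? starVertices v D
        ... | yes x∈ = x∈
        ... | no x∉  = contradiction (x , x∉) ¬r∉
        n≤∣starVertices∣ : n ≤ suc ∣ D ∣
        n≤∣starVertices∣ = subst₂ _≤_ (∣⊤∣≡n n) ∣starVertices∣ (p⊆q⇒∣p∣≤∣q∣ all-in)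
        room′ : suc (suc ∣ D ∣) ≤ n
        room′ = ≤-trans (subst (_≤ suc ∣ D ∣ + ∣ D ∣) (+-comm (suc ∣ D ∣) 1) (+-monoʳ-≤ (suc ∣ D ∣) 1≤∣D∣))
                        room

      private
        r₀∉ = proj₂ outside-vertex

      D-nonempty : Nonempty D
      D-nonempty with nonempty? D
      ... | yes ne = ne
      ... | no ¬ne = contradiction (subst (1 ≤_) (trans (cong ∣_∣ (Empty-unique ¬ne)) (∣⊥∣≡0 n)) 1≤∣D∣) λ ()

      deleteStar-connected : Connected (deleteStar v D)
      deleteStar-connected x y = proj₁ (deleteStar-diameter≤2 r₀∉ x y)

      starVertices-maximal : MaximalGP (deleteStar v D) (starVertices v D)
      starVertices-maximal =
        ¬obstruction⇒gp r₀∉ (λ (_ , _ , _ , _ , r∈ , _ , r∉) → r∉ r∈) ,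
        λ T (star⊆T , x , x∈T , x∉star) → obstruction⇒¬gp
          (d , x , star⊆T centre∈starVertices , star⊆T (∈starVertices⁺ d∈D) , x∈T , d∈D , x∉star)
        where
        d = proj₁ D-nonempty
        d∈D = proj₂ D-nonempty

      maximal-absorbs : ∀ {S x} → MaximalGP (deleteStar v D) S → ¬ Obstruction (S ∪ ⁅ x ⁆) → x ∈ S
      maximal-absorbs maxS ¬obs = maximal-closed (deleteStar v D) maxS λ _ → ¬obstruction⇒gp r₀∉ ¬obs

      -- S contains ∁ ⁅ v ⁆ if v ∉ S, contains ∁ D if S also has a vertex outside the star,
      -- and contains ⁅ v ⁆ ∪ D otherwise.
      maximal⇒1+∣D∣≤∣S∣ : ∀ {S} → MaximalGP (deleteStar v D) S → suc ∣ D ∣ ≤ ∣ S ∣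
      maximal⇒1+∣D∣≤∣S∣ {S} maxS@(gpS , _) with v ∈? S | any? (λ r → r ∈? S ×-dec ¬? (r ∈? starVertices v D))
      ... | no v∉S | _ = ≤-trans ∣D∣<n∸1 (subst (_≤ ∣ S ∣) ∣∁⁅v⁆∣ (p⊆q⇒∣p∣≤∣q∣ λ x∈∁ →
          maximal-absorbs maxS λ (_ , _ , v∈ , _) → case x∈p∪⁅y⁆⁻ v∈ of λ where
            (inj₁ v∈S)  → v∉S v∈S
            (inj₂ refl) → x∈∁p⇒x∉p x∈∁ (x∈⁅x⁆ v)))
      ... | yes v∈S | yes (r , r∈S , r∉) =
        ≤-trans ∣D∣<n∸∣D∣ (subst (_≤ ∣ S ∣) (∣∁p∣≡n∸∣p∣ D) (p⊆q⇒∣p∣≤∣q∣ λ x∈∁ →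
          maximal-absorbs maxS λ (d , _ , _ , d∈ , _ , d∈D , _) → case x∈p∪⁅y⁆⁻ d∈ of λ where
            (inj₁ d∈S)  → obstruction⇒¬gp (d , r , v∈S , d∈S , r∈S , d∈D , r∉) gpS
            (inj₂ refl) → x∈∁p⇒x∉p x∈∁ d∈D))
      ... | yes v∈S | no ¬r = subst (_≤ ∣ S ∣) ∣starVertices∣ (p⊆q⇒∣p∣≤∣q∣ λ x∈ →
          maximal-absorbs maxS λ (_ , r , _ , _ , r∈ , _ , r∉) → case x∈p∪⁅y⁆⁻ r∈ of λ where
            (inj₁ r∈S)  → ¬r (r , r∈S , r∉)
            (inj₂ refl) → r∉ x∈)

      deleteStar-gp⁻ : GpMinusIs (deleteStar v D) (suc ∣ D ∣)
      deleteStar-gp⁻ = (starVertices v D , starVertices-maximal , ∣starVertices∣) , λ _ → maximal⇒1+∣D∣≤∣S∣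

deleteStar-extremal : ∀ {n j} (v : Fin n) (D : Subset n) → v ∉ D → ∣ D ∣ ≡ suc j →
  suc (suc j) + suc j ≤ n →
  Connected (deleteStar v D) × GpMinusIs (deleteStar v D) (suc (suc j))
  × edgeCount (deleteStar v D) + suc (suc j) ≡ n C 2 + 1
deleteStar-extremal {n} v D v∉D ∣D∣≡1+j room =
    deleteStar-connected v∉D 1≤∣D∣ room′
  , subst (λ m → GpMinusIs (deleteStar v D) (suc m)) ∣D∣≡1+j (deleteStar-gp⁻ v∉D 1≤∣D∣ room′)
  , subst (λ m → edgeCount (deleteStar v D) + suc m ≡ n C 2 + 1) ∣D∣≡1+j (edgeCount-deleteStar v∉D)
  where
  1≤∣D∣ : 1 ≤ ∣ D ∣
  1≤∣D∣ = subst (1 ≤_) (sym ∣D∣≡1+j) (s≤s z≤n)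
  room′ : suc ∣ D ∣ + ∣ D ∣ ≤ n
  room′ = subst (λ m → suc m + m ≤ n) (sym ∣D∣≡1+j) room

record GpSetWithNonEdge {n} (G : Graph n) (k : ℕ) : Set where
  field
    S     : Subset n
    a b   : Fin n
    gp    : GeneralPosition G S
    a∈S   : a ∈ S
    b∈S   : b ∈ S
    a≢b   : a ≢ b
    a≁b   : adj G a b ≡ false
    k≤∣S∣ : k ≤ ∣ S ∣

StarShaped : ∀ {n} → Graph n → ℕ → Set
StarShaped {n} G k = ∃ λ (v : Fin n) → ∃ λ (D : Subset n) →
  v ∉ D × ∣ D ∣ ≡ k ∸ 1 × SameGraph G (deleteStar v D)

starShaped? : ∀ {n} (G : Graph n) k → Dec (StarShaped G k)
starShaped? G k = any? λ v → anySubset? λ D →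
  ¬? (v ∈? D) ×-dec ∣ D ∣ ≟ℕ k ∸ 1 ×-dec all? (λ x → all? (λ y → adj G x y ≟ᵇ adj (deleteStar v D) x y))

module _ {n : ℕ} (G : Graph n) {k : ℕ} where

  nonadjacent-pair : k ≢ n → GpMinusIs G k → ∃ λ a → ∃ λ b → a ≢ b × adj G a b ≡ false
  nonadjacent-pair k≢n gpm with any? (λ a → any? (λ b → ¬? (a ≟ b) ×-dec adj G a b ≟ᵇ false))
  ... | yes (a , b , ab) = a , b , ab
  ... | no none = contradiction (complete⇒gp⁻≡n G complete gpm) k≢n
    where
    complete : ∀ x y → x ≢ y → adj G x y ≡ true
    complete x y x≢y with adj G x y in x~y
    ... | true  = refl
    ... | false = contradiction (x , y , x≢y , x~y) none

  ¬¬gpSetWithNonEdge : k ≢ n → GpMinusIs G k → ¬ ¬ GpSetWithNonEdge G k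
  ¬¬gpSetWithNonEdge k≢n gpm with nonadjacent-pair k≢n gpm
  ... | a , b , a≢b , a≁b = ¬¬-map witness (extend-to-maximal G (⁅ a ⁆ ∪ ⁅ b ⁆) (gp-⁅⁆∪⁅⁆ G a b))
    where
    witness : MaximalAbove G (⁅ a ⁆ ∪ ⁅ b ⁆) → GpSetWithNonEdge G k
    witness (S , ab⊆S , maxS) = record
      { S = S ; a = a ; b = b ; gp = proj₁ maxS
      ; a∈S = ab⊆S (x∈p∪q⁺ (inj₁ (x∈⁅x⁆ a))) ; b∈S = ab⊆S (x∈p∪q⁺ (inj₂ (x∈⁅x⁆ b)))
      ; a≢b = a≢b ; a≁b = a≁b ; k≤∣S∣ = proj₂ gpm S maxS }

  module _ (w : GpSetWithNonEdge G k) where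
    open GpSetWithNonEdge w
    open Spokes G gp a∈S b∈S a≢b a≁b

    edgeCount-bound : edgeCount G + k ≤ n C 2 + 1
    edgeCount-bound = ≤-trans (+-monoʳ-≤ (edgeCount G) (≤-trans k≤∣S∣ ∣S∣≤suc-length-nonEdges))
                              (≤-reflexive (edgeCount+suc|nonEdges|≡nC2+1 G))

    module _ (tight : edgeCount G + k ≡ n C 2 + 1) where

      private
        k≡1+N : k ≡ suc (length (nonEdges G))
        k≡1+N = +-cancelˡ-≡ (edgeCount G) _ _ (trans tight (sym (edgeCount+suc|nonEdges|≡nC2+1 G)))

        ∣S∣≡k : ∣ S ∣ ≡ k
        ∣S∣≡k = ≤-antisym (subst (∣ S ∣ ≤_) (sym k≡1+N) ∣S∣≤suc-length-nonEdges) k≤∣S∣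

        covered : nonEdges G ⊆ᴸ spokes
        covered = unique∧xs⊆ys∧|ys|≤|xs|⇒ys⊆xs (≡-dec _≟_ _≟_) spokes-unique spokes⊆nonEdges
          (≤-pred (≤-reflexive (trans (sym k≡1+N) (trans (sym ∣S∣≡k) (sym suc-length-spokes)))))

      tight⇒starShaped : StarShaped G k
      tight⇒starShaped with centre covered
      ... | c , c-centre = c , S - c , (λ c∈ → x∈p-y⇒x≢y {p = S} c∈ refl) ,
                           cong (_∸ 1) (trans (x∈p⇒suc∣p-x∣≡∣p∣ (c∈S covered c-centre)) ∣S∣≡k) ,
                           centre⇒SameGraph covered c-centre

2*[1+m]≤n+1⇒[1+m]+m≤n : ∀ {m n} → 2 * suc m ≤ n + 1 → suc m + m ≤ n
2*[1+m]≤n+1⇒[1+m]+m≤n {m} {n} 2[1+m]≤n+1 = ≤-pred (subst₂ _≤_ 2[1+m]≡ (+-comm n 1) 2[1+m]≤n+1)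
  where
  2[1+m]≡ : 2 * suc m ≡ suc (suc m + m)
  2[1+m]≡ = trans (cong (suc m +_) (+-identityʳ (suc m))) (+-suc (suc m) m)

theorem3p5 : (n : ℕ) (G : Graph n) (k : ℕ) →
    Connected G → GpMinusIs G k → 2 ≤ k → 2 * k ≤ n + 1 →
    -- m(G) ≤ C(n,2) - k + 1
    (edgeCount G + k ≤ n C 2 + 1)
    -- any graph in the class attaining the bound is K_n minus k-1 edges at one vertex
    × (edgeCount G + k ≡ n C 2 + 1 →
        ∃ λ (v : Fin n) → ∃ λ (D : Subset n) →
          v ∉ D × ∣ D ∣ ≡ k ∸ 1 × SameGraph G (deleteStar v D))
    -- and that graph indeed attains the bound (is connected with gp⁻ = k)
    × ((v : Fin n) (D : Subset n) → v ∉ D → ∣ D ∣ ≡ k ∸ 1 →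
        Connected (deleteStar v D) × GpMinusIs (deleteStar v D) k
        × edgeCount (deleteStar v D) + k ≡ n C 2 + 1)
theorem3p5 n G (suc (suc j)) _ gpm (s≤s (s≤s z≤n)) 2k≤n+1 =
    decidable-stable (_ ≤? _) (¬¬-map (edgeCount-bound G) witness)
  , (λ tight → decidable-stable (starShaped? G (suc (suc j)))
                                 (¬¬-map (λ w → tight⇒starShaped G w tight) witness))
  , λ v D v∉D ∣D∣≡k∸1 → deleteStar-extremal v D v∉D ∣D∣≡k∸1 room
  where
  room : suc (suc j) + suc j ≤ n
  room = 2*[1+m]≤n+1⇒[1+m]+m≤n {suc j} 2k≤n+1
  witness : ¬ ¬ GpSetWithNonEdge G (suc (suc j))
  witness = ¬¬gpSetWithNonEdge G (<⇒≢ (≤-trans (s≤s (s≤s (m≤n+m (suc j) j))) room)) gpm
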